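{- Let $G$ be a simple graph without isolated vertices and let $D\subseteq V_G$. Then $D$ is the unique minimum paired-dominating set of $G$ if and only if every minimum edge-vertex dominating set $M$ of $G$ satisfies $V_G(M)=D$.
   Context: All graphs are finite and simple. For $M\subseteq E_G$, $V_G(M)$ denotes the set of vertices incident to edges of $M$. A set $D\subseteq V_G$ is dominating if every vertex outside $D$ has a neighbour in $D$; it is a paired-dominating set if it is dominating and the induced subgraph $G[D]$ has a perfect matching; minimum means of minimum cardinality. An edge $e$ ev-dominates a vertex $v$ if $e$ is incident to $v$ or $e$ is incident to a vertex adjacent to $v$. A set $M\subseteq E_G$ is an edge-vertex dominating set if every vertex is ev-dominated by some edge of $M$; minimum means of minimum cardinality. -}

module Defs where

open import Data.Nat using (ℕ; _<_; _≤_)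
open import Data.Bool using (Bool; true; false; T; if_then_else_; _∧_)
open import Data.Fin using (Fin; toℕ)
open import Data.Fin.Subset using (Subset; _∈_; _∉_; ∣_∣)
open import Data.List using (map; allFin)
open import Data.Nat.ListAction using (sum)
open import Data.Product using (Σ; ∃; _×_)
open import Data.Sum using (_⊎_)
open import Relation.Binary.PropositionalEquality using (_≡_)
open import Relation.Nullary using (¬_)
open import Data.Nat using (_<ᵇ_)

record Graph (n : ℕ) : Set where
  field
    adj    : Fin n → Fin n → Bool
    sym    : ∀ u v → adj u v ≡ adj v u
    irrefl : ∀ v → adj v v ≡ false

module _ {n : ℕ} (G : Graph n) where
  open Graph G

  Adj : Fin n → Fin n → Set
  Adj u v = T (adj u v)

  NoIsolated : Set
  NoIsolated = ∀ v → ∃ λ u → Adj v u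

-- A set of (unordered) pairs of vertices, encoded by M : Fin n → Fin n → Bool where
-- the pair {u,v} with toℕ u < toℕ v belongs to the set iff M u v ≡ true
-- (entries with toℕ u ≥ toℕ v are ignored).
PairSet : ℕ → Set
PairSet n = Fin n → Fin n → Bool

InM : ∀ {n} → PairSet n → Fin n → Fin n → Set
InM M u v = (toℕ u < toℕ v × T (M u v)) ⊎ (toℕ v < toℕ u × T (M v u))

esize : ∀ {n} → PairSet n → ℕ
esize {n} M = sum (map (λ u → sum (map (λ v →
  if (toℕ u <ᵇ toℕ v) ∧ M u v then 1 else 0) (allFin n))) (allFin n))

module _ {n : ℕ} (G : Graph n) where

  IsEdgeSet : PairSet n → Set
  IsEdgeSet M = ∀ u v → InM M u v → Adj G u v

  InVM : PairSet n → Fin n → Set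
  InVM M v = ∃ λ u → InM M v u

  EvDominatesBy : Fin n → Fin n → Fin n → Set
  EvDominatesBy u v w = (u ≡ w ⊎ v ≡ w) ⊎ (Adj G u w ⊎ Adj G v w)

  IsEVDS : PairSet n → Set
  IsEVDS M = IsEdgeSet M × (∀ w → ∃ λ u → ∃ λ v → InM M u v × EvDominatesBy u v w)

  IsMinEVDS : PairSet n → Set
  IsMinEVDS M = IsEVDS M × (∀ M′ → IsEVDS M′ → esize M ≤ esize M′)

  IsDominating : Subset n → Set
  IsDominating D = ∀ v → v ∉ D → ∃ λ u → u ∈ D × Adj G u v

  HasPerfectMatchingInduced : Subset n → Set
  HasPerfectMatchingInduced D = ∃ λ (P : PairSet n) →
      (∀ u v → InM P u v → Adj G u v × u ∈ D × v ∈ D)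
    × (∀ v → v ∈ D → ∃ λ u → InM P v u × (∀ w → InM P v w → w ≡ u))

  IsPDS : Subset n → Set
  IsPDS D = IsDominating D × HasPerfectMatchingInduced D

  IsMinPDS : Subset n → Set
  IsMinPDS D = IsPDS D × (∀ D′ → IsPDS D′ → ∣ D ∣ ≤ ∣ D′ ∣)

  IsUniqueMinPDS : Subset n → Set
  IsUniqueMinPDS D = IsMinPDS D × (∀ D′ → IsMinPDS D′ → D′ ≡ D)

module Submission where

-- A perfect matching P of a paired-dominating set D is an edge-vertex dominating set with
-- V(P) = D and |D| = 2|P|, and conversely V(M) is a paired-dominating set of size 2|M| for
-- every edge-vertex dominating matching M.  So a minimum edge-vertex dominating set that is
-- a matching spans a minimum paired-dominating set, and every minimum paired-dominating set
-- is spanned by a minimum edge-vertex dominating matching.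
--
-- If a vertex b has two partners a ≠ c in a minimum
-- edge-vertex dominating set M, then M − ab is smaller, hence not dominating: some w is
-- ev-dominated by ab alone.  Then a ~ w, w ∉ V(M), and M − ab + aw is again minimum, with
-- vertex set V(M) ∪ {w}.  If all minimum sets have the same vertex set D, no exchange is
-- possible, so they are matchings and D is the unique minimum paired-dominating set.  If D
-- is the unique minimum paired-dominating set, induct on n − |V(M)|: exchanging at the two
-- partners x, y of v yields matchings, both spanning D, so the two new vertices coincide,
-- and that vertex would then be ev-dominated by both xv and yv.

open import Data.Nat using (ℕ)
open import Data.Fin.Subset using (Subset; _∈_)
open import Function.Bundles using (_⇔_)
open import Defs

import Data.Nat.Properties as ℕ
open import Algebra.Properties.CommutativeMonoid.Sum ℕ.+-0-commutativeMonoid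
  using (sum-syntax; sum-cong-≗; sum-replicate-zero; sum-remove; ∑-distrib-+; ∑-comm)
open import Data.Bool.Base using (true; false; T; if_then_else_; _∧_)
open import Data.Bool.Properties using (T-∧; T-≡)
open import Data.Empty using (⊥; ⊥-elim)
open import Data.Fin.Base as Fin using (Fin; toℕ; punchIn)
open import Data.Fin.Properties
  using (_≟_; _<?_; <-cmp; <-asym; <-irrefl; punchInᵢ≢i; any?; all?; ¬∀⟶∃¬)
open import Data.Fin.Subset using (inside; outside; ∣_∣; _⊆_)
open import Data.Fin.Subset.Properties using (_∈?_; ⊆-antisym; p⊂q⇒∣p∣<∣q∣; ∣p∣≤n)
open import Data.List.Base as List using (List; map; allFin; tabulate; cartesianProductWith; filter)
open import Data.List.Extrema ℕ.≤-totalOrder using (argmin; argmin-all; f[argmin]≤f[xs])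
open import Data.List.Membership.Propositional using () renaming (_∈_ to _∈ᴸ_)
open import Data.List.Membership.Propositional.Properties using (∈-cartesianProductWith⁺; ∈-filter⁺)
import Data.List.Relation.Unary.All as All
open import Data.List.Relation.Unary.All.Properties using (all-filter)
open import Data.List.Relation.Unary.Any using (here; there)
open import Data.Nat.Base using (zero; suc; _+_; _*_; _≤_; _<_; _<ᵇ_)
open import Data.Nat.ListAction using () renaming (sum to sumᴸ)
open import Data.Product.Base using (∃; _×_; _,_; proj₁; proj₂)
open import Data.Sum.Base as Sum using (_⊎_; inj₁; inj₂; [_,_]; [_,_]′)
open import Data.Vec.Base as Vec using ([]; _∷_)
import Data.Vec.Functional as Vector
open import Data.Vec.Properties using (lookup∘tabulate; []=⇒lookup; lookup⇒[]=)
open import Function.Base using (_∘_; id)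
open import Function.Bundles using (mk⇔; Equivalence)
open import Relation.Binary.Definitions using (tri<; tri≈; tri>)
open import Relation.Binary.PropositionalEquality
  using (_≡_; _≢_; refl; sym; trans; cong; cong₂; subst; subst₂; module ≡-Reasoning)
open import Relation.Nullary using (¬_; Dec; yes; no; does)
open import Relation.Nullary.Decidable
  using ( _×-dec_; _⊎-dec_; _→-dec_; ¬?; decidable-stable; isYes; toSum; toWitness; fromWitness
        ; dec-true; dec-false; does-⇔ )
open import Relation.Nullary.Decidable.Core using (T?)
open import Relation.Unary using (Decidable)

private variable
  n : ℕ
  P Q : Set

𝟙 : Dec P → ℕ
𝟙 P? = if does P? then 1 else 0

𝟙-yes : (P? : Dec P) → P → 𝟙 P? ≡ 1
𝟙-yes P? p = cong (λ b → if b then 1 else 0) (dec-true P? p)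

𝟙-no : (P? : Dec P) → ¬ P → 𝟙 P? ≡ 0
𝟙-no P? ¬p = cong (λ b → if b then 1 else 0) (dec-false P? ¬p)

𝟙-cong : P ⇔ Q → (P? : Dec P) (Q? : Dec Q) → 𝟙 P? ≡ 𝟙 Q?
𝟙-cong P⇔Q P? Q? = cong (λ b → if b then 1 else 0) (does-⇔ P⇔Q P? Q?)

𝟙-⊎ : ¬ (P × Q) → (P? : Dec P) (Q? : Dec Q) → 𝟙 (P? ⊎-dec Q?) ≡ 𝟙 P? + 𝟙 Q?
𝟙-⊎ disjoint (yes p) (yes q) = ⊥-elim (disjoint (p , q))
𝟙-⊎ disjoint (yes p) (no _)  = refl
𝟙-⊎ disjoint (no _)  (yes q) = refl
𝟙-⊎ disjoint (no _)  (no _)  = refl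

∑-zero : (f : Fin n → ℕ) → (∀ i → f i ≡ 0) → ∑[ i < n ] f i ≡ 0
∑-zero {n} f f≡0 = trans (sum-cong-≗ f≡0) (sum-replicate-zero n)

∑-single : (f : Fin n → ℕ) (j : Fin n) → (∀ i → i ≢ j → f i ≡ 0) → ∑[ i < n ] f i ≡ f j
∑-single {suc n} f j f≡0 = begin
  ∑[ i < suc n ] f i                ≡⟨ sum-remove {i = j} f ⟩
  f j + ∑[ i < n ] f (punchIn j i)  ≡⟨ cong (f j +_) (∑-zero _ λ i → f≡0 _ (punchInᵢ≢i j i)) ⟩
  f j + 0                           ≡⟨ ℕ.+-identityʳ (f j) ⟩
  f j                               ∎
  where open ≡-Reasoning

∑-𝟙-unique : {R : Fin n → Set} (R? : ∀ i → Dec (R i)) (j : Fin n) →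
  R j → (∀ i → R i → i ≡ j) → ∑[ i < n ] 𝟙 (R? i) ≡ 1
∑-𝟙-unique R? j Rj unique =
  trans (∑-single _ j λ i i≢j → 𝟙-no (R? i) (i≢j ∘ unique i)) (𝟙-yes (R? j) Rj)

∑-𝟙-none : {R : Fin n → Set} (R? : ∀ i → Dec (R i)) → (∀ i → ¬ R i) → ∑[ i < n ] 𝟙 (R? i) ≡ 0
∑-𝟙-none R? ¬R = ∑-zero _ λ i → 𝟙-no (R? i) (¬R i)

sumᴸ-map-allFin : (f : Fin n → ℕ) → sumᴸ (map f (allFin n)) ≡ ∑[ i < n ] f i
sumᴸ-map-allFin = sumᴸ-map-tabulate id
  where
  sumᴸ-map-tabulate : ∀ {n} {A : Set} (g : Fin n → A) (f : A → ℕ) →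
    sumᴸ (map f (tabulate g)) ≡ ∑[ i < n ] f (g i)
  sumᴸ-map-tabulate {zero}  g f = refl
  sumᴸ-map-tabulate {suc n} g f = cong (f (g Fin.zero) +_) (sumᴸ-map-tabulate (g ∘ Fin.suc) f)

∣p∣≡∑𝟙∈ : (p : Subset n) → ∣ p ∣ ≡ ∑[ i < n ] 𝟙 (i ∈? p)
∣p∣≡∑𝟙∈ []            = refl
∣p∣≡∑𝟙∈ (inside ∷ p)  = cong suc (∣p∣≡∑𝟙∈ p)
∣p∣≡∑𝟙∈ (outside ∷ p) = ∣p∣≡∑𝟙∈ p

InM? : (X : PairSet n) (u v : Fin n) → Dec (InM X u v)
InM? X u v = (u <? v ×-dec T? (X u v)) ⊎-dec (v <? u ×-dec T? (X v u))

InM-sym : {X : PairSet n} {u v : Fin n} → InM X u v → InM X v u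
InM-sym (inj₁ p) = inj₂ p
InM-sym (inj₂ p) = inj₁ p

InM⇒≢ : {X : PairSet n} {u v : Fin n} → InM X u v → u ≢ v
InM⇒≢ (inj₁ (u<v , _)) refl = <-irrefl refl u<v
InM⇒≢ (inj₂ (v<u , _)) refl = <-irrefl refl v<u

_≐_ : PairSet n → PairSet n → Set
X ≐ Y = ∀ u v → X u v ≡ Y u v

InM-resp : {X Y : PairSet n} → X ≐ Y → ∀ {u v} → InM X u v → InM Y u v
InM-resp X≐Y {u} {v} (inj₁ (u<v , uv)) = inj₁ (u<v , subst T (X≐Y u v) uv)
InM-resp X≐Y {u} {v} (inj₂ (v<u , vu)) = inj₂ (v<u , subst T (X≐Y v u) vu)

IsMatching : PairSet n → Set
IsMatching M = ∀ {v x y} → InM M v x → InM M v y → x ≡ y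

degree : PairSet n → Fin n → ℕ
degree {n} X u = ∑[ v < n ] 𝟙 (InM? X u v)

private
  esize-term : PairSet n → Fin n → Fin n → ℕ
  esize-term X u v = 𝟙 (T? ((toℕ u <ᵇ toℕ v) ∧ X u v))

  esize≡∑∑ : (X : PairSet n) → esize X ≡ ∑[ u < n ] ∑[ v < n ] esize-term X u v
  esize≡∑∑ {n} X = trans (sumᴸ-map-allFin (λ u → sumᴸ (map (esize-term X u) (allFin n))))
                         (sum-cong-≗ λ u → sumᴸ-map-allFin (esize-term X u))

  esize-term-sym : (X : PairSet n) (u v : Fin n) →
    esize-term X u v + esize-term X v u ≡ 𝟙 (InM? X u v)
  esize-term-sym X u v = begin
    esize-term X u v + esize-term X v u
      ≡⟨ cong₂ _+_ (esize-term≡ u v) (esize-term≡ v u) ⟩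
    𝟙 (u <? v ×-dec T? (X u v)) + 𝟙 (v <? u ×-dec T? (X v u))
      ≡⟨ 𝟙-⊎ (λ ((u<v , _) , (v<u , _)) → <-asym u<v v<u)
             (u <? v ×-dec T? (X u v)) (v <? u ×-dec T? (X v u)) ⟨
    𝟙 (InM? X u v) ∎
    where
    open ≡-Reasoning
    <ᵇ∧⇔ : ∀ u v → T ((toℕ u <ᵇ toℕ v) ∧ X u v) ⇔ (toℕ u < toℕ v × T (X u v))
    <ᵇ∧⇔ u v = mk⇔ (λ t → let (p , q) = Equivalence.to T-∧ t in ℕ.<ᵇ⇒< (toℕ u) (toℕ v) p , q)
                   (λ (p , q) → Equivalence.from T-∧ (ℕ.<⇒<ᵇ p , q))
    esize-term≡ : ∀ u v → esize-term X u v ≡ 𝟙 (u <? v ×-dec T? (X u v))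
    esize-term≡ u v = 𝟙-cong (<ᵇ∧⇔ u v) (T? ((toℕ u <ᵇ toℕ v) ∧ X u v)) (u <? v ×-dec T? (X u v))

esize-handshake : (X : PairSet n) → 2 * esize X ≡ ∑[ u < n ] degree X u
esize-handshake {n} X = begin
  2 * esize X
    ≡⟨ cong (2 *_) (esize≡∑∑ X) ⟩
  2 * S
    ≡⟨ cong (S +_) (ℕ.+-identityʳ S) ⟩
  S + S
    ≡⟨ cong (S +_) (∑-comm (esize-term X)) ⟩
  S + ∑[ u < n ] ∑[ v < n ] esize-term X v u
    ≡⟨ ∑-distrib-+ (λ u → ∑[ v < n ] esize-term X u v) (λ u → ∑[ v < n ] esize-term X v u) ⟨
  ∑[ u < n ] (∑[ v < n ] esize-term X u v + ∑[ v < n ] esize-term X v u)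
    ≡⟨ sum-cong-≗ (λ u → ∑-distrib-+ (esize-term X u) (λ v → esize-term X v u)) ⟨
  ∑[ u < n ] ∑[ v < n ] (esize-term X u v + esize-term X v u)
    ≡⟨ sum-cong-≗ (λ u → sum-cong-≗ (esize-term-sym X u)) ⟩
  ∑[ u < n ] degree X u ∎
  where
  open ≡-Reasoning
  S = ∑[ u < n ] ∑[ v < n ] esize-term X u v

esize-cong : {X Y : PairSet n} → X ≐ Y → esize X ≡ esize Y
esize-cong {X = X} {Y} X≐Y = begin
  esize X                                 ≡⟨ esize≡∑∑ X ⟩
  ∑[ u < _ ] ∑[ v < _ ] esize-term X u v  ≡⟨ sum-cong-≗ (λ u → sum-cong-≗ λ v →
                                               cong (λ b → 𝟙 (T? ((toℕ u <ᵇ toℕ v) ∧ b))) (X≐Y u v)) ⟩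
  ∑[ u < _ ] ∑[ v < _ ] esize-term Y u v  ≡⟨ esize≡∑∑ Y ⟨
  esize Y                                 ∎
  where open ≡-Reasoning

IsPair : Fin n → Fin n → Fin n → Fin n → Set
IsPair a b u v = (u ≡ a × v ≡ b) ⊎ (u ≡ b × v ≡ a)

IsPair? : (a b u v : Fin n) → Dec (IsPair a b u v)
IsPair? a b u v = (u ≟ a ×-dec v ≟ b) ⊎-dec (u ≟ b ×-dec v ≟ a)

IsPair-sym : {a b u v : Fin n} → IsPair a b u v → IsPair a b v u
IsPair-sym (inj₁ (p , q)) = inj₂ (q , p)
IsPair-sym (inj₂ (p , q)) = inj₁ (q , p)

IsPair⇒≢ : {a b u v : Fin n} → a ≢ b → IsPair a b u v → u ≢ v
IsPair⇒≢ a≢b (inj₁ (refl , refl)) = a≢b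
IsPair⇒≢ a≢b (inj₂ (refl , refl)) = a≢b ∘ sym

∑∑-𝟙-point : (a b : Fin n) → ∑[ u < n ] ∑[ v < n ] 𝟙 (u ≟ a ×-dec v ≟ b) ≡ 1
∑∑-𝟙-point {n} a b = trans (sum-cong-≗ row) (∑-𝟙-unique (_≟ a) a refl (λ _ → id))
  where
  row : ∀ u → ∑[ v < n ] 𝟙 (u ≟ a ×-dec v ≟ b) ≡ 𝟙 (u ≟ a)
  row u with u ≟ a
  ... | yes u≡a = ∑-𝟙-unique (λ v → yes u≡a ×-dec v ≟ b) b (u≡a , refl) (λ _ → proj₂)
  ... | no u≢a  = ∑-𝟙-none (λ v → no u≢a ×-dec v ≟ b) (λ _ → u≢a ∘ proj₁)

∑∑-𝟙-IsPair : {a b : Fin n} → a ≢ b → ∑[ u < n ] ∑[ v < n ] 𝟙 (IsPair? a b u v) ≡ 2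
∑∑-𝟙-IsPair {n} {a} {b} a≢b = begin
  ∑[ u < n ] ∑[ v < n ] 𝟙 (IsPair? a b u v)
    ≡⟨ sum-cong-≗ (λ u → trans (sum-cong-≗ (split u)) (∑-distrib-+ (ab u) (ba u))) ⟩
  ∑[ u < n ] (∑[ v < n ] ab u v + ∑[ v < n ] ba u v)
    ≡⟨ ∑-distrib-+ (λ u → ∑[ v < n ] ab u v) (λ u → ∑[ v < n ] ba u v) ⟩
  ∑[ u < n ] ∑[ v < n ] ab u v + ∑[ u < n ] ∑[ v < n ] ba u v
    ≡⟨ cong₂ _+_ (∑∑-𝟙-point a b) (∑∑-𝟙-point b a) ⟩
  2 ∎
  where
  open ≡-Reasoning
  ab ba : Fin n → Fin n → ℕ
  ab u v = 𝟙 (u ≟ a ×-dec v ≟ b)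
  ba u v = 𝟙 (u ≟ b ×-dec v ≟ a)
  split : ∀ u v → 𝟙 (IsPair? a b u v) ≡ ab u v + ba u v
  split u v = 𝟙-⊎ (λ ((u≡a , _) , (u≡b , _)) → a≢b (trans (sym u≡a) u≡b))
                  (u ≟ a ×-dec v ≟ b) (u ≟ b ×-dec v ≟ a)

esize-extend : {X Y : PairSet n} {a b : Fin n} → a ≢ b →
  (∀ {u v} → InM Y u v ⇔ (InM X u v ⊎ IsPair a b u v)) →
  (∀ {u v} → InM X u v → ¬ IsPair a b u v) →
  esize Y ≡ suc (esize X)
esize-extend {n} {X} {Y} {a} {b} a≢b Y⇔X+ab X∌ab = ℕ.*-cancelˡ-≡ _ _ 2 (begin
  2 * esize Y
    ≡⟨ esize-handshake Y ⟩
  ∑[ u < n ] degree Y u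
    ≡⟨ sum-cong-≗ (λ u → trans (sum-cong-≗ (split u)) (∑-distrib-+ (λ v → 𝟙 (InM? X u v)) (ab u))) ⟩
  ∑[ u < n ] (degree X u + ∑[ v < n ] ab u v)
    ≡⟨ ∑-distrib-+ (degree X) (λ u → ∑[ v < n ] ab u v) ⟩
  ∑[ u < n ] degree X u + ∑[ u < n ] ∑[ v < n ] ab u v
    ≡⟨ cong₂ _+_ (sym (esize-handshake X)) (∑∑-𝟙-IsPair a≢b) ⟩
  2 * esize X + 2
    ≡⟨ ℕ.+-comm _ 2 ⟩
  2 + 2 * esize X
    ≡⟨ ℕ.*-suc 2 (esize X) ⟨
  2 * suc (esize X) ∎)
  where
  open ≡-Reasoning
  ab : Fin n → Fin n → ℕ
  ab u v = 𝟙 (IsPair? a b u v)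
  split : ∀ u v → 𝟙 (InM? Y u v) ≡ 𝟙 (InM? X u v) + ab u v
  split u v = trans (𝟙-cong Y⇔X+ab (InM? Y u v) (InM? X u v ⊎-dec IsPair? a b u v))
                    (𝟙-⊎ (λ (x , p) → X∌ab x p) (InM? X u v) (IsPair? a b u v))

toPairSet : {R : Fin n → Fin n → Set} → (∀ u v → Dec (R u v)) → PairSet n
toPairSet R? u v = isYes (R? u v)

InM-toPairSet : {R : Fin n → Fin n → Set} (R? : ∀ u v → Dec (R u v)) →
  (∀ {u v} → R u v → R v u) → ∀ {u v} → InM (toPairSet R?) u v ⇔ (R u v × u ≢ v)
InM-toPairSet {R = R} R? R-sym {u} {v} = mk⇔ to from
  where
  to : InM (toPairSet R?) u v → R u v × u ≢ v
  to m@(inj₁ (_ , r)) = toWitness r , InM⇒≢ {X = toPairSet R?} m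
  to m@(inj₂ (_ , r)) = R-sym (toWitness r) , InM⇒≢ {X = toPairSet R?} m
  from : R u v × u ≢ v → InM (toPairSet R?) u v
  from (r , u≢v) with <-cmp u v
  ... | tri< u<v _ _ = inj₁ (u<v , fromWitness r)
  ... | tri≈ _ u≡v _ = ⊥-elim (u≢v u≡v)
  ... | tri> _ _ v<u = inj₂ (v<u , fromWitness (R-sym r))

-- Opaque, so that only the characterisations below are ever used: unfolding
-- these decision procedures during unification is prohibitively slow.
opaque
  removePair insertPair : PairSet n → Fin n → Fin n → PairSet n
  removePair X a b = toPairSet λ u v → InM? X u v ×-dec ¬? (IsPair? a b u v)
  insertPair X a b = toPairSet λ u v → InM? X u v ⊎-dec IsPair? a b u v

  InM-removePair : (X : PairSet n) (a b : Fin n) →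
    ∀ {u v} → InM (removePair X a b) u v ⇔ (InM X u v × ¬ IsPair a b u v)
  InM-removePair X a b = mk⇔ (proj₁ ∘ to) (λ (x , ¬ab) → from ((x , ¬ab) , InM⇒≢ {X = X} x))
    where
    open Equivalence (InM-toPairSet (λ u v → InM? X u v ×-dec ¬? (IsPair? a b u v))
                                    λ (x , ¬ab) → InM-sym {X = X} x , ¬ab ∘ IsPair-sym)

  InM-insertPair : (X : PairSet n) (a b : Fin n) → a ≢ b →
    ∀ {u v} → InM (insertPair X a b) u v ⇔ (InM X u v ⊎ IsPair a b u v)
  InM-insertPair X a b a≢b = mk⇔ (proj₁ ∘ to) (λ r → from (r , [ InM⇒≢ {X = X} , IsPair⇒≢ a≢b ] r))
    where
    open Equivalence (InM-toPairSet (λ u v → InM? X u v ⊎-dec IsPair? a b u v)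
                                    (Sum.map (InM-sym {X = X}) IsPair-sym))

module _ (X : PairSet n) (a b : Fin n) where

  esize-removePair : InM X a b → esize X ≡ suc (esize (removePair X a b))
  esize-removePair ab∈X = esize-extend (InM⇒≢ {X = X} ab∈X) (mk⇔ to from)
                                       (proj₂ ∘ Equivalence.to (InM-removePair X a b))
    where
    to : ∀ {u v} → InM X u v → InM (removePair X a b) u v ⊎ IsPair a b u v
    to {u} {v} x = [ inj₂ , (λ ¬ab → inj₁ (Equivalence.from (InM-removePair X a b) (x , ¬ab))) ]′
                     (toSum (IsPair? a b u v))
    from : ∀ {u v} → InM (removePair X a b) u v ⊎ IsPair a b u v → InM X u v
    from (inj₁ x)                    = proj₁ (Equivalence.to (InM-removePair X a b) x)
    from (inj₂ (inj₁ (refl , refl))) = ab∈X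
    from (inj₂ (inj₂ (refl , refl))) = InM-sym {X = X} ab∈X

  esize-insertPair : a ≢ b → (∀ {u v} → InM X u v → ¬ IsPair a b u v) →
    esize (insertPair X a b) ≡ suc (esize X)
  esize-insertPair a≢b = esize-extend a≢b (InM-insertPair X a b a≢b)

functions : {A : Set} → List A → (k : ℕ) → List (Fin k → A)
functions xs zero    = List.[ (λ ()) ]
functions xs (suc k) = cartesianProductWith Vector._∷_ xs (functions xs k)

functions-complete : {A : Set} (_≈_ : A → A → Set) {xs : List A} →
  (∀ a → ∃ λ a′ → a′ ∈ᴸ xs × a ≈ a′) →
  ∀ {k} (f : Fin k → A) → ∃ λ g → g ∈ᴸ functions xs k × (∀ i → f i ≈ g i)
functions-complete _≈_ complete {zero}  f = (λ ()) , here refl , λ ()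
functions-complete _≈_ complete {suc k} f
  with complete (f Fin.zero) | functions-complete _≈_ complete (f ∘ Fin.suc)
... | a , a∈xs , f₀≈a | g , g∈ , f≈g =
  a Vector.∷ g , ∈-cartesianProductWith⁺ Vector._∷_ a∈xs g∈ ,
  λ { Fin.zero → f₀≈a ; (Fin.suc i) → f≈g i }

minimum-exists : {A : Set} (_≈_ : A → A → Set) (xs : List A) →
  (∀ a → ∃ λ a′ → a′ ∈ᴸ xs × a ≈ a′) →
  {P : A → Set} → Decidable P → (∀ {a a′} → a ≈ a′ → P a → P a′) →
  (f : A → ℕ) → (∀ {a a′} → a ≈ a′ → f a ≡ f a′) →
  ∀ {a} → P a → ∃ λ m → P m × (∀ a → P a → f m ≤ f a)
minimum-exists _≈_ xs complete {P} P? P-resp f f-resp {a} Pa =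
  m , argmin-all f Pa (all-filter P? xs) , minimal
  where
  m = argmin f a (filter P? xs)
  minimal : ∀ a′ → P a′ → f m ≤ f a′
  minimal a′ Pa′ with complete a′
  ... | a″ , a″∈xs , a′≈a″ = subst (f m ≤_) (sym (f-resp a′≈a″))
    (All.lookup (f[argmin]≤f[xs] a (filter P? xs)) (∈-filter⁺ P? a″∈xs (P-resp a′≈a″ Pa′)))

-- Pair sets are functions, so without function extensionality they can only be
-- enumerated up to pointwise equality.
pairSets : (n : ℕ) → List (PairSet n)
pairSets n = functions (functions (true List.∷ false List.∷ List.[]) n) n

pairSets-complete : (X : PairSet n) → ∃ λ Y → Y ∈ᴸ pairSets n × X ≐ Y
pairSets-complete = functions-complete _ (functions-complete _≡_ bool-complete)
  where
  bool-complete : ∀ b → ∃ λ b′ → b′ ∈ᴸ (true List.∷ false List.∷ List.[]) × b ≡ b′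
  bool-complete true  = true , here refl , refl
  bool-complete false = false , there (here refl) , refl

module _ (G : Graph n) where
  open Graph G using (adj)
  open Equivalence

  Adj-sym : ∀ {u v} → Adj G u v → Adj G v u
  Adj-sym {u} {v} = subst T (Graph.sym G u v)

  Adj⇒≢ : ∀ {u v} → Adj G u v → u ≢ v
  Adj⇒≢ {v = v} v~v refl = subst T (Graph.irrefl G v) v~v

  EvDominated : PairSet n → Fin n → Set
  EvDominated M w = ∃ λ u → ∃ λ v → InM M u v × EvDominatesBy G u v w

  EvDominatesBy? : ∀ u v w → Dec (EvDominatesBy G u v w)
  EvDominatesBy? u v w = (u ≟ w ⊎-dec v ≟ w) ⊎-dec (T? (adj u w) ⊎-dec T? (adj v w))

  EvDominated? : ∀ M w → Dec (EvDominated M w)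
  EvDominated? M w = any? λ u → any? λ v → InM? M u v ×-dec EvDominatesBy? u v w

  IsEVDS? : ∀ M → Dec (IsEVDS G M)
  IsEVDS? M = all? (λ u → all? λ v → InM? M u v →-dec T? (adj u v)) ×-dec all? (EvDominated? M)

  IsEVDS-resp : ∀ {X Y} → X ≐ Y → IsEVDS G X → IsEVDS G Y
  IsEVDS-resp X≐Y (edges , dominated) =
    (λ u v uv → edges u v (InM-resp (λ u v → sym (X≐Y u v)) uv)) ,
    λ w → let (u , v , uv , uv↝w) = dominated w in u , v , InM-resp X≐Y uv , uv↝w

  IsPair-EvDominatesBy : ∀ {a b u v w} → IsPair a b u v → EvDominatesBy G u v w → EvDominatesBy G a b w
  IsPair-EvDominatesBy (inj₁ (refl , refl)) = id
  IsPair-EvDominatesBy (inj₂ (refl , refl)) = Sum.map Sum.swap Sum.swap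

  allEdges : PairSet n
  allEdges = toPairSet λ u v → T? (adj u v)

  allEdges-EVDS : NoIsolated G → IsEVDS G allEdges
  allEdges-EVDS noIsolated =
    (λ u v uv → proj₁ (to allEdges⇔ uv)) ,
    λ w → let (u , w~u) = noIsolated w in w , u , from allEdges⇔ (w~u , Adj⇒≢ w~u) , inj₁ (inj₁ refl)
    where
    allEdges⇔ : ∀ {u v} → InM allEdges u v ⇔ (Adj G u v × u ≢ v)
    allEdges⇔ = InM-toPairSet (λ u v → T? (adj u v)) Adj-sym

  minEVDS-exists : NoIsolated G → ∃ (IsMinEVDS G)
  minEVDS-exists noIsolated = minimum-exists _≐_ (pairSets n) pairSets-complete IsEVDS? IsEVDS-resp
                                             esize esize-cong (allEdges-EVDS noIsolated)

  InVM? : ∀ M v → Dec (InVM G M v)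
  InVM? M v = any? (InM? M v)

  vertices : PairSet n → Subset n
  vertices M = Vec.tabulate λ v → isYes (InVM? M v)

  ∈-vertices : ∀ {M v} → v ∈ vertices M ⇔ InVM G M v
  ∈-vertices {M} {v} = mk⇔
    (λ v∈ → toWitness (from T-≡ (trans (sym (lookup∘tabulate _ v)) ([]=⇒lookup v∈))))
    (λ v∈ → lookup⇒[]= v _ (trans (lookup∘tabulate _ v) (to T-≡ (fromWitness v∈))))

  vertices≡⇔ : ∀ {M D} → vertices M ≡ D ⇔ (∀ v → InVM G M v ⇔ v ∈ D)
  vertices≡⇔ = mk⇔ (λ { refl v → mk⇔ (from ∈-vertices) (to ∈-vertices) })
                   (λ M⇔D → ⊆-antisym (to (M⇔D _) ∘ to ∈-vertices) (from ∈-vertices ∘ from (M⇔D _)))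

  ∣vertices∣≡2*esize : ∀ {M} → IsMatching M → ∣ vertices M ∣ ≡ 2 * esize M
  ∣vertices∣≡2*esize {M} matching = begin
    ∣ vertices M ∣                  ≡⟨ ∣p∣≡∑𝟙∈ (vertices M) ⟩
    ∑[ v < n ] 𝟙 (v ∈? vertices M)  ≡⟨ sum-cong-≗ 𝟙∈≡degree ⟩
    ∑[ v < n ] degree M v           ≡⟨ esize-handshake M ⟨
    2 * esize M                     ∎
    where
    open ≡-Reasoning
    𝟙∈≡degree : ∀ v → 𝟙 (v ∈? vertices M) ≡ degree M v
    𝟙∈≡degree v with v ∈? vertices M
    ... | yes v∈ = let (u , vu) = to ∈-vertices v∈ in
                   sym (∑-𝟙-unique (InM? M v) u vu λ x vx → matching vx vu)
    ... | no v∉  = sym (∑-𝟙-none (InM? M v) λ x vx → v∉ (from ∈-vertices (x , vx)))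

  matching-EVDS⇒PDS : ∀ {M} → IsEVDS G M → IsMatching M → IsPDS G (vertices M)
  matching-EVDS⇒PDS {M} (edges , dominated) matching = dominating , M , within , perfect
    where
    endpoint : ∀ {u v} → InM M u v → u ∈ vertices M
    endpoint uv = from ∈-vertices (_ , uv)
    dominating : IsDominating G (vertices M)
    dominating w w∉ with dominated w
    ... | u , v , uv , inj₁ (inj₁ refl) = ⊥-elim (w∉ (endpoint uv))
    ... | u , v , uv , inj₁ (inj₂ refl) = ⊥-elim (w∉ (endpoint (InM-sym {X = M} uv)))
    ... | u , v , uv , inj₂ (inj₁ u~w)  = u , endpoint uv , u~w
    ... | u , v , uv , inj₂ (inj₂ v~w)  = v , endpoint (InM-sym {X = M} uv) , v~w
    within : ∀ u v → InM M u v → Adj G u v × u ∈ vertices M × v ∈ vertices M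
    within u v uv = edges u v uv , endpoint uv , endpoint (InM-sym {X = M} uv)
    perfect : ∀ v → v ∈ vertices M → ∃ λ u → InM M v u × (∀ w → InM M v w → w ≡ u)
    perfect v v∈ = let (u , vu) = to ∈-vertices v∈ in u , vu , λ w vw → matching vw vu

  PDS⇒matching-EVDS : ∀ {D} → IsPDS G D → ∃ λ P → IsEVDS G P × IsMatching P × vertices P ≡ D
  PDS⇒matching-EVDS {D} (dominating , P , within , perfect) =
    P , (edges , dominated) , matching , ⊆-antisym endpoint (from ∈-vertices ∘ partner)
    where
    edges : IsEdgeSet G P
    edges u v uv = proj₁ (within u v uv)
    endpoint : vertices P ⊆ D
    endpoint v∈ = let (x , vx) = to ∈-vertices v∈ in proj₁ (proj₂ (within _ x vx))
    partner : ∀ {v} → v ∈ D → InVM G P v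
    partner v∈D = let (u , vu , _) = perfect _ v∈D in u , vu
    matching : IsMatching P
    matching {v} {x} {y} vx vy =
      let (u , _ , unique) = perfect v (endpoint (from ∈-vertices (x , vx))) in
      trans (unique x vx) (sym (unique y vy))
    dominated : ∀ w → EvDominated P w
    dominated w with w ∈? D
    ... | yes w∈D = let (u , wu) = partner w∈D in w , u , wu , inj₁ (inj₁ refl)
    ... | no w∉D  = let (u , u∈D , u~w) = dominating w w∉D ; (x , ux) = partner u∈D in
                    u , x , ux , inj₂ (inj₁ u~w)

  2*minEVDS≤PDS : ∀ {M D} → IsMinEVDS G M → IsPDS G D → 2 * esize M ≤ ∣ D ∣
  2*minEVDS≤PDS {M} (_ , minimal) D-pds with PDS⇒matching-EVDS D-pds
  ... | P , P-evds , P-matching , refl =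
    subst (2 * esize M ≤_) (sym (∣vertices∣≡2*esize P-matching)) (ℕ.*-monoʳ-≤ 2 (minimal P P-evds))

  matching-minEVDS⇒minPDS : ∀ {M} → IsMinEVDS G M → IsMatching M → IsMinPDS G (vertices M)
  matching-minEVDS⇒minPDS M-min matching =
    matching-EVDS⇒PDS (proj₁ M-min) matching ,
    λ D D-pds → subst (_≤ ∣ D ∣) (sym (∣vertices∣≡2*esize matching)) (2*minEVDS≤PDS M-min D-pds)

  minPDS⇒minEVDS : ∀ {M D} → IsMinEVDS G M → IsMatching M → IsMinPDS G D →
    ∃ λ P → IsMinEVDS G P × vertices P ≡ D
  minPDS⇒minEVDS {M} M-min M-matching (D-pds , D-min) with PDS⇒matching-EVDS D-pds
  ... | P , P-evds , P-matching , refl =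
    P , (P-evds , λ X X-evds → ℕ.≤-trans P≤M (proj₂ M-min X X-evds)) , refl
    where
    P≤M : esize P ≤ esize M
    P≤M = ℕ.*-cancelˡ-≤ 2 (subst₂ _≤_ (∣vertices∣≡2*esize P-matching) (∣vertices∣≡2*esize M-matching)
                             (D-min (vertices M) (matching-EVDS⇒PDS (proj₁ M-min) M-matching)))

  removePair-undominates : ∀ {M a b} → IsMinEVDS G M → InM M a b →
    ∃ λ w → ¬ EvDominated (removePair M a b) w
  removePair-undominates {M} {a} {b} M-min ab∈M =
    ¬∀⟶∃¬ n (EvDominated M⁻) (EvDominated? M⁻) λ M⁻-dominated → ℕ.<-irrefl refl
      (subst (_≤ esize M⁻) (esize-removePair M a b ab∈M) (proj₂ M-min M⁻ (M⁻-edges , M⁻-dominated)))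
    where
    M⁻ = removePair M a b
    M⁻-edges : IsEdgeSet G M⁻
    M⁻-edges u v uv = proj₁ (proj₁ M-min) u v (proj₁ (to (InM-removePair M a b) uv))

  -- M′ = M − ab + aw, for a vertex w that only ab ev-dominates.
  record Exchange (M : PairSet n) (a b : Fin n) : Set where
    field
      w                   : Fin n
      M′                  : PairSet n
      a~w                 : Adj G a w
      only-ab-dominates-w : ∀ {u v} → InM M u v → EvDominatesBy G u v w → IsPair a b u v
      w∉VM                : ¬ InVM G M w
      M′-min              : IsMinEVDS G M′
      VM⊆VM′              : ∀ {v} → InVM G M v → InVM G M′ v
      w∈VM′               : InVM G M′ w
      VM′⊆VM∪w            : ∀ {v} → InVM G M′ v → InVM G M v ⊎ v ≡ w

  module _ {M : PairSet n} (M-min : IsMinEVDS G M) {a b c : Fin n}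
           (ba∈M : InM M b a) (bc∈M : InM M b c) (a≢c : a ≢ c)
           {w : Fin n} (w-undominated : ¬ EvDominated (removePair M a b) w) where
    private
      edges : IsEdgeSet G M
      edges = proj₁ (proj₁ M-min)

      ab∈M : InM M a b
      ab∈M = InM-sym {X = M} ba∈M

      M⁻ : PairSet n
      M⁻ = removePair M a b

      M⁻⇔ : ∀ {u v} → InM M⁻ u v ⇔ (InM M u v × ¬ IsPair a b u v)
      M⁻⇔ = InM-removePair M a b

      kept : ∀ {u v} → InM M u v → ¬ IsPair a b u v → InM M⁻ u v
      kept uv ¬ab = from M⁻⇔ (uv , ¬ab)

      M⁻-edges : IsEdgeSet G M⁻
      M⁻-edges u v uv = edges u v (proj₁ (to M⁻⇔ uv))

      bc∈M⁻ : InM M⁻ b c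
      bc∈M⁻ = kept bc∈M λ { (inj₁ (b≡a , _)) → InM⇒≢ {X = M} ba∈M b≡a
                          ; (inj₂ (_ , c≡a)) → a≢c (sym c≡a) }

      bc-misses-w : ¬ EvDominatesBy G b c w
      bc-misses-w bc↝w = w-undominated (b , c , bc∈M⁻ , bc↝w)

      only-ab-dominates-w : ∀ {u v} → InM M u v → EvDominatesBy G u v w → IsPair a b u v
      only-ab-dominates-w {u} {v} uv uv↝w = decidable-stable (IsPair? a b u v)
        λ ¬ab → w-undominated (u , v , kept uv ¬ab , uv↝w)

      ab↝w⇒a~w : EvDominatesBy G a b w → Adj G a w
      ab↝w⇒a~w (inj₁ (inj₁ a≡w)) =
        ⊥-elim (bc-misses-w (inj₂ (inj₁ (subst (Adj G b) a≡w (edges b a ba∈M)))))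
      ab↝w⇒a~w (inj₁ (inj₂ b≡w)) = ⊥-elim (bc-misses-w (inj₁ (inj₁ b≡w)))
      ab↝w⇒a~w (inj₂ (inj₁ a~w)) = a~w
      ab↝w⇒a~w (inj₂ (inj₂ b~w)) = ⊥-elim (bc-misses-w (inj₂ (inj₁ b~w)))

      a~w : Adj G a w
      a~w = let (u , v , uv , uv↝w) = proj₂ (proj₁ M-min) w in
            ab↝w⇒a~w (IsPair-EvDominatesBy (only-ab-dominates-w uv uv↝w) uv↝w)

      a≢w : a ≢ w
      a≢w = Adj⇒≢ a~w

      w∉VM : ¬ InVM G M w
      w∉VM (x , wx) with only-ab-dominates-w wx (inj₁ (inj₁ refl))
      ... | inj₁ (w≡a , _) = a≢w (sym w≡a)
      ... | inj₂ (w≡b , _) = bc-misses-w (inj₁ (inj₁ (sym w≡b)))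

      M′ : PairSet n
      M′ = insertPair M⁻ a w

      M′⇔ : ∀ {u v} → InM M′ u v ⇔ (InM M⁻ u v ⊎ IsPair a w u v)
      M′⇔ = InM-insertPair M⁻ a w a≢w

      M⁻∌aw : ∀ {u v} → InM M⁻ u v → ¬ IsPair a w u v
      M⁻∌aw uv (inj₁ (refl , refl)) = w∉VM (_ , InM-sym {X = M} (proj₁ (to M⁻⇔ uv)))
      M⁻∌aw uv (inj₂ (refl , refl)) = w∉VM (_ , proj₁ (to M⁻⇔ uv))

      aw∈M′ : InM M′ a w
      aw∈M′ = from M′⇔ (inj₂ (inj₁ (refl , refl)))

      M⁻⊆M′ : ∀ {u v} → InM M⁻ u v → InM M′ u v
      M⁻⊆M′ = from M′⇔ ∘ inj₁

      M′-edges : IsEdgeSet G M′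
      M′-edges u v uv with to M′⇔ uv
      ... | inj₁ uv⁻                   = M⁻-edges u v uv⁻
      ... | inj₂ (inj₁ (refl , refl)) = a~w
      ... | inj₂ (inj₂ (refl , refl)) = Adj-sym a~w

      M′-dominated : ∀ z → EvDominated M′ z
      M′-dominated z with proj₂ (proj₁ M-min) z
      ... | u , v , uv , uv↝z with IsPair? a b u v
      ... | no ¬ab = u , v , M⁻⊆M′ (kept uv ¬ab) , uv↝z
      ... | yes ab with IsPair-EvDominatesBy ab uv↝z
      ... | inj₁ (inj₁ a≡z) = a , w , aw∈M′ , inj₁ (inj₁ a≡z)
      ... | inj₁ (inj₂ b≡z) = b , c , M⁻⊆M′ bc∈M⁻ , inj₁ (inj₁ b≡z)
      ... | inj₂ (inj₁ a~z) = a , w , aw∈M′ , inj₂ (inj₁ a~z)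
      ... | inj₂ (inj₂ b~z) = b , c , M⁻⊆M′ bc∈M⁻ , inj₂ (inj₁ b~z)

      M′-min : IsMinEVDS G M′
      M′-min = (M′-edges , M′-dominated) ,
               λ X X-evds → subst (_≤ esize X) (sym same-size) (proj₂ M-min X X-evds)
        where
        same-size : esize M′ ≡ esize M
        same-size = trans (esize-insertPair M⁻ a w a≢w M⁻∌aw) (sym (esize-removePair M a b ab∈M))

      VM⊆VM′ : ∀ {v} → InVM G M v → InVM G M′ v
      VM⊆VM′ {v} (x , vx) with IsPair? a b v x
      ... | no ¬ab                    = x , M⁻⊆M′ (kept vx ¬ab)
      ... | yes (inj₁ (refl , refl)) = w , aw∈M′
      ... | yes (inj₂ (refl , refl)) = c , M⁻⊆M′ bc∈M⁻

      VM′⊆VM∪w : ∀ {v} → InVM G M′ v → InVM G M v ⊎ v ≡ w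
      VM′⊆VM∪w (x , vx) with to M′⇔ vx
      ... | inj₁ vx⁻                   = inj₁ (x , proj₁ (to M⁻⇔ vx⁻))
      ... | inj₂ (inj₁ (refl , refl)) = inj₁ (b , ab∈M)
      ... | inj₂ (inj₂ (refl , refl)) = inj₂ refl

    exchange-at : Exchange M a b
    exchange-at = record
      { w = w ; M′ = M′ ; a~w = a~w ; only-ab-dominates-w = only-ab-dominates-w ; w∉VM = w∉VM
      ; M′-min = M′-min ; VM⊆VM′ = VM⊆VM′ ; w∈VM′ = a , InM-sym {X = M′} aw∈M′ ; VM′⊆VM∪w = VM′⊆VM∪w }

  exchange : ∀ {M a b c} → IsMinEVDS G M → InM M b a → InM M b c → a ≢ c → Exchange M a b
  exchange {M} M-min ba∈M bc∈M a≢c =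
    exchange-at M-min ba∈M bc∈M a≢c (proj₂ (removePair-undominates M-min (InM-sym {X = M} ba∈M)))

  exchange-grows : ∀ {M a b} (E : Exchange M a b) → ∣ vertices M ∣ < ∣ vertices (Exchange.M′ E) ∣
  exchange-grows E = p⊂q⇒∣p∣<∣q∣
    ( from ∈-vertices ∘ VM⊆VM′ ∘ to ∈-vertices
    , w , from ∈-vertices w∈VM′ , w∉VM ∘ to ∈-vertices )
    where open Exchange E

  exchanges-differ : ∀ {M v x y} → InM M v x → x ≢ y → (E₁ : Exchange M x v) (E₂ : Exchange M y v) →
    vertices (Exchange.M′ E₁) ≢ vertices (Exchange.M′ E₂)
  exchanges-differ {M} {v} {x} {y} vx x≢y E₁ E₂ V₁≡V₂ =
    [ E₂.w∉VM , (λ w₂≡w₁ → xv≢yv (E₂.only-ab-dominates-w (InM-sym {X = M} vx) (xv↝w₂ w₂≡w₁))) ]′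
    (E₁.VM′⊆VM∪w (to ∈-vertices (subst (E₂.w ∈_) (sym V₁≡V₂) (from ∈-vertices E₂.w∈VM′))))
    where
    module E₁ = Exchange E₁
    module E₂ = Exchange E₂
    xv↝w₂ : E₂.w ≡ E₁.w → EvDominatesBy G x v E₂.w
    xv↝w₂ w₂≡w₁ = inj₂ (inj₁ (subst (Adj G x) (sym w₂≡w₁) E₁.a~w))
    xv≢yv : ¬ IsPair y v x v
    xv≢yv (inj₁ (x≡y , _)) = x≢y x≡y
    xv≢yv (inj₂ (x≡v , _)) = InM⇒≢ {X = M} vx (sym x≡v)

  matching⇒vertices≡ : ∀ {D M} → IsUniqueMinPDS G D → IsMinEVDS G M → IsMatching M → vertices M ≡ D
  matching⇒vertices≡ D-unique M-min matching = proj₂ D-unique _ (matching-minEVDS⇒minPDS M-min matching)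

  -- k bounds the number of vertices outside V(M); each exchange adds one.
  uniqueMinPDS⇒matching : ∀ {D} → IsUniqueMinPDS G D →
    ∀ k {M} → IsMinEVDS G M → n ≤ ∣ vertices M ∣ + k → IsMatching M
  uniqueMinPDS⇒matching {D} D-unique k {M} M-min bound {v} {x} {y} vx vy with x ≟ y
  ... | yes x≡y = x≡y
  ... | no x≢y  = ⊥-elim (impossible k bound)
    where
    E₁ = exchange M-min vx vy x≢y
    E₂ = exchange M-min vy vx (x≢y ∘ sym)
    impossible : ∀ k → n ≤ ∣ vertices M ∣ + k → ⊥
    impossible zero bound = ℕ.<-irrefl refl (ℕ.<-≤-trans (exchange-grows E₁)
      (ℕ.≤-trans (∣p∣≤n (vertices (Exchange.M′ E₁))) (subst (n ≤_) (ℕ.+-identityʳ _) bound)))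
    impossible (suc k) bound =
      exchanges-differ vx x≢y E₁ E₂ (trans (vertices≡D E₁) (sym (vertices≡D E₂)))
      where
      vertices≡D : ∀ {a} (E : Exchange M a v) → vertices (Exchange.M′ E) ≡ D
      vertices≡D E = matching⇒vertices≡ D-unique M′-min (uniqueMinPDS⇒matching D-unique k M′-min bound′)
        where
        open Exchange E
        bound′ : n ≤ ∣ vertices M′ ∣ + k
        bound′ = ℕ.≤-trans bound (subst (_≤ ∣ vertices M′ ∣ + k) (sym (ℕ.+-suc _ k))
                                        (ℕ.+-monoˡ-≤ k (exchange-grows E)))

  uniqueMinPDS⇒vertices≡ : ∀ {D M} → IsUniqueMinPDS G D → IsMinEVDS G M → vertices M ≡ D
  uniqueMinPDS⇒vertices≡ D-unique M-min =
    matching⇒vertices≡ D-unique M-min (uniqueMinPDS⇒matching D-unique n M-min (ℕ.m≤n+m n _))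

  sameVertices⇒matching : ∀ {D} → (∀ {M} → IsMinEVDS G M → vertices M ≡ D) →
    ∀ {M} → IsMinEVDS G M → IsMatching M
  sameVertices⇒matching same M-min {v} {x} {y} vx vy with x ≟ y
  ... | yes x≡y = x≡y
  ... | no x≢y  = ⊥-elim (w∉VM (to ∈-vertices
      (subst (w ∈_) (trans (same M′-min) (sym (same M-min))) (from ∈-vertices w∈VM′))))
    where open Exchange (exchange M-min vx vy x≢y)

  sameVertices⇒uniqueMinPDS : ∀ {D} → NoIsolated G → (∀ {M} → IsMinEVDS G M → vertices M ≡ D) →
    IsUniqueMinPDS G D
  sameVertices⇒uniqueMinPDS noIsolated same =
    subst (IsMinPDS G) (same M₀-min) (matching-minEVDS⇒minPDS M₀-min M₀-matching) , unique
    where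
    M₀-min = proj₂ (minEVDS-exists noIsolated)
    M₀-matching = sameVertices⇒matching same M₀-min
    unique : ∀ D′ → IsMinPDS G D′ → D′ ≡ _
    unique D′ D′-min = let (P , P-min , VP≡D′) = minPDS⇒minEVDS M₀-min M₀-matching D′-min in
                       trans (sym VP≡D′) (same P-min)

corollary6 : {n : ℕ} (G : Graph n) → NoIsolated G → (D : Subset n) →
    (IsUniqueMinPDS G D ⇔
    (∀ M → IsMinEVDS G M → ∀ v → (InVM G M v ⇔ v ∈ D)))
corollary6 G noIsolated D = mk⇔
  (λ D-unique M M-min → Equivalence.to (vertices≡⇔ G) (uniqueMinPDS⇒vertices≡ G D-unique M-min))
  (λ all⇔ → sameVertices⇒uniqueMinPDS G noIsolated
              λ M-min → Equivalence.from (vertices≡⇔ G) (all⇔ _ M-min))
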